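{- Every edge preorder $E\in C(m,n)$ contains exactly two vertex preorders, i.e. there are exactly two vertex preorders $P\in C(m,n)$ with $P\le E$.
   Context: Fix positive integers $m,n$. $\mathsf{Coll}(m,n)$ is the finite set of formal symbols $m_1,\dots,m_{m-1}$ and $l_1,\dots,l_{n-1}$. A preorder is a reflexive transitive relation $\le$; $x\equiv y$ means $x\le y$ and $y\le x$, $x<y$ means $x\le y$ but not $y\le x$, and $x,y$ are comparable if $x\le y$ or $y\le x$. Pairs $\{m_j,l_i\}$ are orthogonal; pairs $\{m_j,m_{j'}\}$ or $\{l_i,l_{i'}\}$ are parallel. Given a preorder, an orthogonal link between parallel $m_i,m_j$ is an $l_s$ with $m_i\le l_s\le m_j$ or $m_j\le l_s\le m_i$; a gap between $m_i,m_j$ is an $m_s$ with $s$ between $i$ and $j$ inclusive and $m_i<m_s$, $m_j<m_s$; links and gaps between $l_i,l_j$ are defined symmetrically. A preorder is a good rectangular preorder if (1) any two orthogonal collisions are comparable, and (2) two parallel collisions are comparable iff there is an orthogonal link between them or there is no gap between them. $C(m,n)$ is the set of good rectangular preorders ordered by refinement: $P\le Q$ iff $x\le_P y$ implies $x\le_Q y$. A vertex preorder is a good rectangular preorder in which $x\equiv y$ implies $x=y$. An edge preorder is a good rectangular preorder in which exactly one equivalence class has two elements and every other equivalence class has one element. -}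

module Defs where

open import Data.Nat using (ℕ; pred)
open import Data.Fin using (Fin; toℕ)
open import Data.Bool using (Bool; true)
open import Data.Sum using (_⊎_; inj₁; inj₂)
open import Data.Product using (_×_; ∃; ∃-syntax; Σ-syntax)
open import Relation.Nullary using (¬_)
open import Relation.Binary.PropositionalEquality using (_≡_; _≢_)
import Data.Nat as N

-- Coll(m,n): m_1..m_{m-1} (inj₁) and l_1..l_{n-1} (inj₂)
Coll : ℕ → ℕ → Set
Coll m n = Fin (pred m) ⊎ Fin (pred n)

record Rel (m n : ℕ) : Set where
  constructor mkRel
  field rel : Coll m n → Coll m n → Bool
open Rel public

module _ {m n : ℕ} (R : Rel m n) where

  _≤R_ : Coll m n → Coll m n → Set
  x ≤R y = rel R x y ≡ true

  _<R_ : Coll m n → Coll m n → Set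
  x <R y = x ≤R y × ¬ (y ≤R x)

  _≈R_ : Coll m n → Coll m n → Set
  x ≈R y = x ≤R y × y ≤R x

  Comparable : Coll m n → Coll m n → Set
  Comparable x y = x ≤R y ⊎ y ≤R x

  IsPreorder : Set
  IsPreorder = (∀ x → x ≤R x) × (∀ x y z → x ≤R y → y ≤R z → x ≤R z)

  Between : {k : ℕ} → Fin k → Fin k → Fin k → Set
  Between i j s = (toℕ i N.≤ toℕ s × toℕ s N.≤ toℕ j) ⊎ (toℕ j N.≤ toℕ s × toℕ s N.≤ toℕ i)

  LinkM : Fin (pred m) → Fin (pred m) → Set
  LinkM i j = ∃[ s ] ((inj₁ i ≤R inj₂ s × inj₂ s ≤R inj₁ j) ⊎ (inj₁ j ≤R inj₂ s × inj₂ s ≤R inj₁ i))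

  GapM : Fin (pred m) → Fin (pred m) → Set
  GapM i j = ∃[ s ] (Between i j s × inj₁ i <R inj₁ s × inj₁ j <R inj₁ s)

  LinkL : Fin (pred n) → Fin (pred n) → Set
  LinkL i j = ∃[ s ] ((inj₂ i ≤R inj₁ s × inj₁ s ≤R inj₂ j) ⊎ (inj₂ j ≤R inj₁ s × inj₁ s ≤R inj₂ i))

  GapL : Fin (pred n) → Fin (pred n) → Set
  GapL i j = ∃[ s ] (Between i j s × inj₂ i <R inj₂ s × inj₂ j <R inj₂ s)

  record IsGoodRectangular : Set where
    field
      preorder   : IsPreorder
      orthogonal : ∀ j i → Comparable (inj₁ j) (inj₂ i)
      parallelM₁ : ∀ i j → Comparable (inj₁ i) (inj₁ j) → LinkM i j ⊎ ¬ GapM i j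
      parallelM₂ : ∀ i j → LinkM i j ⊎ ¬ GapM i j → Comparable (inj₁ i) (inj₁ j)
      parallelL₁ : ∀ i j → Comparable (inj₂ i) (inj₂ j) → LinkL i j ⊎ ¬ GapL i j
      parallelL₂ : ∀ i j → LinkL i j ⊎ ¬ GapL i j → Comparable (inj₂ i) (inj₂ j)

  IsVertex : Set
  IsVertex = IsGoodRectangular × (∀ x y → x ≈R y → x ≡ y)

  IsEdge : Set
  IsEdge = IsGoodRectangular ×
    Σ[ x ∈ Coll m n ] Σ[ y ∈ Coll m n ] (x ≢ y × x ≈R y ×
      (∀ u v → u ≈R v → u ≡ v ⊎ ((u ≡ x × v ≡ y) ⊎ (u ≡ y × v ≡ x))))

_⊑_ : {m n : ℕ} → Rel m n → Rel m n → Set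
P ⊑ Q = ∀ x y → _≤R_ P x y → _≤R_ Q x y

_≐_ : {m n : ℕ} → Rel m n → Rel m n → Set
P ≐ Q = ∀ x y → rel P x y ≡ rel Q x y

{-# OPTIONS --safe #-}
module Submission where

-- Let {lo, hi} be the two-element class of the edge E. E has neither an orthogonal link nor a gap
-- between lo and hi, so every good P ⊑ E compares them; by symmetry take lo ≤ hi. Breaking the class
-- as lo < hi turns E into a partial order Split. Deleting from Split the comparabilities of parallel
-- pairs that have a gap but no orthogonal link gives a vertex preorder Pruned: the key point is that a
-- gap in Split lifts to a gap in Pruned, by climbing from a gap whose comparability was deleted to the
-- gap responsible for the deletion, which terminates because Split is a finite partial order. Finally
-- every vertex P ⊑ E with lo ≤ hi lies inside Split, and conditions (1) and (2) force it to agree with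
-- Pruned pair by pair.

open import Defs hiding (Comparable; Between)
open import Data.Bool using (Bool; true; false)
open import Data.Bool.Properties using (⇔→≡) renaming (_≟_ to _≟ᵇ_)
open import Data.Empty using (⊥-elim)
open import Data.Fin using (Fin; toℕ; join; splitAt)
open import Data.Fin.Induction using (po-noetherian)
open import Data.Fin.Properties using (toℕ-injective; any?; splitAt-join) renaming (_≟_ to _≟ᶠ_)
open import Data.Nat using (ℕ; _≤_; _≤?_)
open import Data.Nat.Properties using (≤-trans; ≤-total; ≤-antisym)
open import Data.Product using (_×_; _,_; proj₁; proj₂; ∃; ∃-syntax)
open import Data.Sum using (_⊎_; inj₁; inj₂; [_,_]′; map; map₂; swap)
open import Data.Sum.Function.Propositional using (_⊎-cong_)
open import Data.Sum.Properties using (≡-dec)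
open import Function using (_∘_; flip)
open import Function.Bundles using (_⇔_; mk⇔; Equivalence)
open import Function.Properties.Equivalence using () renaming (trans to ⇔-trans; sym to ⇔-sym)
open import Function.Related.TypeIsomorphisms using (¬-cong-⇔)
open import Induction.WellFounded using (WellFounded; Acc; acc; module Subrelation)
open import Level using (0ℓ)
open import Relation.Binary.Core using (_⇒_) renaming (Rel to BinRel)
open import Relation.Binary.Definitions using (Reflexive; Transitive; Antisymmetric; Decidable; DecidableEquality)
open import Relation.Binary.Structures using (IsPartialOrder)
import Relation.Binary.Construct.On as On
import Relation.Binary.Construct.NonStrictToStrict as ToStrict
open import Relation.Binary.PropositionalEquality
  using (_≡_; _≢_; refl; sym; trans; cong; subst; subst₂; isEquivalence)
open import Relation.Nullary using (¬_; Dec; yes; no; does)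
open import Relation.Nullary.Decidable using (_×-dec_; _⊎-dec_; ¬?; map′)

does-≡-true⇔ : {A : Set} (a? : Dec A) → does a? ≡ true ⇔ A
does-≡-true⇔ (yes a) = mk⇔ (λ _ → a) (λ _ → refl)
does-≡-true⇔ (no ¬a) = mk⇔ (λ ()) (⊥-elim ∘ ¬a)

module Collisions (m n : ℕ) where

  private
    variable
      a b c s t : Coll m n
      R S : BinRel (Coll m n) 0ℓ

  sort : Coll m n → Bool
  sort = [ (λ _ → true) , (λ _ → false) ]′

  Parallel : BinRel (Coll m n) 0ℓ
  Parallel a b = sort a ≡ sort b

  _≟_ : DecidableEquality (Coll m n)
  _≟_ = ≡-dec _≟ᶠ_ _≟ᶠ_

  parallel? : Decidable Parallel
  parallel? a b = sort a ≟ᵇ sort b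

  position : Coll m n → ℕ
  position = [ toℕ , toℕ ]′

  position-injective : Parallel a b → position a ≡ position b → a ≡ b
  position-injective {inj₁ _} {inj₁ _} _ eq = cong inj₁ (toℕ-injective eq)
  position-injective {inj₂ _} {inj₂ _} _ eq = cong inj₂ (toℕ-injective eq)

  data Between (a b s : Coll m n) : Set where
    ascending  : position a ≤ position s → position s ≤ position b → Between a b s
    descending : position b ≤ position s → position s ≤ position a → Between a b s

  Between⇔ : Between a b s ⇔ (position a ≤ position s × position s ≤ position b
                              ⊎ position b ≤ position s × position s ≤ position a)
  Between⇔ = mk⇔ (λ { (ascending as sb) → inj₁ (as , sb) ; (descending bs sa) → inj₂ (bs , sa) })
                 [ (λ (as , sb) → ascending as sb) , (λ (bs , sa) → descending bs sa) ]′

  Between? : ∀ a b s → Dec (Between a b s)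
  Between? a b s = map′ (Equivalence.from Between⇔) (Equivalence.to Between⇔)
    ((position a ≤? position s ×-dec position s ≤? position b)
      ⊎-dec (position b ≤? position s ×-dec position s ≤? position a))

  Between-sym : Between a b s → Between b a s
  Between-sym (ascending as sb)  = descending as sb
  Between-sym (descending bs sa) = ascending bs sa

  Between-split : ∀ b → Between a c s → Between a b s ⊎ Between b c s
  Between-split {s = s} b (ascending a≤s s≤c) with ≤-total (position s) (position b)
  ... | inj₁ s≤b = inj₁ (ascending a≤s s≤b)
  ... | inj₂ b≤s = inj₂ (ascending b≤s s≤c)
  Between-split {s = s} b (descending c≤s s≤a) with ≤-total (position s) (position b)
  ... | inj₁ s≤b = inj₂ (descending c≤s s≤b)
  ... | inj₂ b≤s = inj₁ (descending b≤s s≤a)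

  Between-nested : Between a b s → Between a s t → Between a b t
  Between-nested (ascending a≤s s≤b)  (ascending a≤t t≤s)  = ascending a≤t (≤-trans t≤s s≤b)
  Between-nested (ascending a≤s s≤b)  (descending s≤t t≤a) =
    ascending (≤-trans a≤s s≤t) (≤-trans t≤a (≤-trans a≤s s≤b))
  Between-nested (descending b≤s s≤a) (ascending a≤t t≤s)  =
    descending (≤-trans b≤s (≤-trans s≤a a≤t)) (≤-trans t≤s s≤a)
  Between-nested (descending b≤s s≤a) (descending s≤t t≤a) = descending (≤-trans b≤s s≤t) t≤a

  Between-self : Parallel a s → Between a a s → s ≡ a
  Between-self p (ascending a≤s s≤a)  = sym (position-injective p (≤-antisym a≤s s≤a))
  Between-self p (descending a≤s s≤a) = sym (position-injective p (≤-antisym a≤s s≤a))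

  ∃? : {P : Coll m n → Set} → (∀ c → Dec (P c)) → Dec (∃ P)
  ∃? {P} P? = map′ [ (λ (i , p) → inj₁ i , p) , (λ (j , p) → inj₂ j , p) ]′ split
                   (any? (P? ∘ inj₁) ⊎-dec any? (P? ∘ inj₂))
    where
    split : ∃ P → ∃ (P ∘ inj₁) ⊎ ∃ (P ∘ inj₂)
    split (inj₁ i , p) = inj₁ (i , p)
    split (inj₂ j , p) = inj₂ (j , p)

  module _ (_≼_ : BinRel (Coll m n) 0ℓ) where

    Strict : BinRel (Coll m n) 0ℓ
    Strict a b = a ≼ b × ¬ b ≼ a

    Comparable : BinRel (Coll m n) 0ℓ
    Comparable a b = a ≼ b ⊎ b ≼ a

    Link : BinRel (Coll m n) 0ℓ
    Link a b = ∃[ t ] (¬ Parallel a t × (a ≼ t × t ≼ b ⊎ b ≼ t × t ≼ a))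

    GapAt : Coll m n → Coll m n → Coll m n → Set
    GapAt a b s = Parallel a s × Between a b s × Strict a s × Strict b s

    Gap : BinRel (Coll m n) 0ℓ
    Gap a b = ∃ (GapAt a b)

    -- Conditions (1) and (2) stated uniformly for both sorts of collisions.
    record IsGood : Set where
      field
        reflexive  : Reflexive _≼_
        transitive : Transitive _≼_
        orthogonal : ∀ {a b} → ¬ Parallel a b → Comparable a b
        parallel   : ∀ {a b} → Parallel a b → Comparable a b ⇔ (Link a b ⊎ ¬ Gap a b)

  Strict? : Decidable R → Decidable (Strict R)
  Strict? R? a b = R? a b ×-dec ¬? (R? b a)

  Link? : Decidable R → Decidable (Link R)
  Link? R? a b = ∃? λ t → ¬? (parallel? a t) ×-dec ((R? a t ×-dec R? t b) ⊎-dec (R? b t ×-dec R? t a))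

  Gap? : Decidable R → Decidable (Gap R)
  Gap? R? a b = ∃? λ s → parallel? a s ×-dec Between? a b s ×-dec Strict? R? a s ×-dec Strict? R? b s

  ≤-Strict-trans : Transitive R → R a b → Strict R b c → Strict R a c
  ≤-Strict-trans R-trans ab (bc , ¬cb) = R-trans ab bc , λ ca → ¬cb (R-trans ca ab)

  Strict-trans : Transitive R → Strict R a b → Strict R b c → Strict R a c
  Strict-trans {R = R} R-trans (ab , _) = ≤-Strict-trans {R = R} R-trans ab

  Strict-resp : R ⇒ S → S ⇒ R → Strict R a b → Strict S a b
  Strict-resp R⇒S S⇒R (ab , ¬ba) = R⇒S ab , ¬ba ∘ S⇒R

  Strict-mono : R ⇒ S → Reflexive R → Antisymmetric _≡_ S → Strict R a b → Strict S a b
  Strict-mono {R = R} R⇒S R-refl S-antisym (ab , ¬ba) =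
    R⇒S ab , λ ba → ¬ba (subst (λ x → R x _) (S-antisym (R⇒S ab) ba) R-refl)

  Strict-noetherian : IsPartialOrder _≡_ R → WellFounded (flip (Strict R))
  Strict-noetherian {R = R} po =
    Subrelation.wellFounded viaFin (On.wellFounded (join _ _) (po-noetherian (On.isPartialOrder (splitAt _) po)))
    where
    viaFin : ∀ {a b} → Strict R b a → ToStrict._<_ _≡_ R (splitAt _ (join _ _ b)) (splitAt _ (join _ _ a))
    viaFin {a} {b} (ba , ¬ab) =
      subst₂ (ToStrict._<_ _≡_ R) (sym (splitAt-join _ _ b)) (sym (splitAt-join _ _ a)) (ba , λ { refl → ¬ab ba })

  Comparable-mono : R ⇒ S → Comparable R a b → Comparable S a b
  Comparable-mono R⇒S = map R⇒S R⇒S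

  Link-mono : R ⇒ S → Link R a b → Link S a b
  Link-mono R⇒S (t , a∦t , inj₁ (at , tb)) = t , a∦t , inj₁ (R⇒S at , R⇒S tb)
  Link-mono R⇒S (t , a∦t , inj₂ (bt , ta)) = t , a∦t , inj₂ (R⇒S bt , R⇒S ta)

  Link-lift : (∀ {a b} → ¬ Parallel a b → R a b → S a b) → Parallel a b → Link R a b → Link S a b
  Link-lift lift p (t , a∦t , inj₁ (at , tb)) = t , a∦t , inj₁ (lift a∦t at , lift (a∦t ∘ trans p ∘ sym) tb)
  Link-lift lift p (t , a∦t , inj₂ (bt , ta)) = t , a∦t , inj₂ (lift (a∦t ∘ trans p) bt , lift (a∦t ∘ sym) ta)

  Link-sym : Parallel a b → Link R a b → Link R b a
  Link-sym p (t , a∦t , l) = t , a∦t ∘ trans p , swap l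

  Gap-map : (∀ {a b} → Strict R a b → Strict S a b) → Gap R a b → Gap S a b
  Gap-map f (s , as , bt , a<s , b<s) = s , as , bt , f a<s , f b<s

  Gap-sym : Parallel a b → Gap R a b → Gap R b a
  Gap-sym p (s , as , bt , a<s , b<s) = s , trans (sym p) as , Between-sym bt , b<s , a<s

  LinkOrNoGap-sym : Parallel a b → Link R a b ⊎ ¬ Gap R a b → Link R b a ⊎ ¬ Gap R b a
  LinkOrNoGap-sym {R = R} p = map (Link-sym {R = R} p) (_∘ Gap-sym {R = R} (sym p))

  IsGood-resp : R ⇒ S → S ⇒ R → IsGood R → IsGood S
  IsGood-resp {R = R} {S = S} R⇒S S⇒R R-good = record
    { reflexive  = R⇒S R.reflexive
    ; transitive = λ ab bc → R⇒S (R.transitive (S⇒R ab) (S⇒R bc))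
    ; orthogonal = Comparable-mono {R = R} R⇒S ∘ R.orthogonal
    ; parallel   = λ p → mk⇔
        (map (Link-mono {R = R} R⇒S) (_∘ Gap-map {R = S} (Strict-resp {R = S} S⇒R R⇒S))
          ∘ Equivalence.to (R.parallel p) ∘ Comparable-mono {R = S} S⇒R)
        (Comparable-mono {R = R} R⇒S ∘ Equivalence.from (R.parallel p)
          ∘ map (Link-mono {R = S} S⇒R) (_∘ Gap-map {R = R} (Strict-resp {R = R} R⇒S S⇒R)))
    }
    where module R = IsGood R-good

  module _ (Q : Rel m n) where

    private
      _≤Q_ : BinRel (Coll m n) 0ℓ
      _≤Q_ = _≤R_ Q

    LinkM⇔Link : ∀ {i j} → LinkM Q i j ⇔ Link _≤Q_ (inj₁ i) (inj₁ j)
    LinkM⇔Link = mk⇔ (λ (t , l) → inj₂ t , (λ ()) , l)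
                     λ { (inj₁ _ , i∦t , _) → ⊥-elim (i∦t refl) ; (inj₂ t , _ , l) → t , l }

    LinkL⇔Link : ∀ {i j} → LinkL Q i j ⇔ Link _≤Q_ (inj₂ i) (inj₂ j)
    LinkL⇔Link = mk⇔ (λ (t , l) → inj₁ t , (λ ()) , l)
                     λ { (inj₂ _ , i∦t , _) → ⊥-elim (i∦t refl) ; (inj₁ t , _ , l) → t , l }

    GapM⇔Gap : ∀ {i j} → GapM Q i j ⇔ Gap _≤Q_ (inj₁ i) (inj₁ j)
    GapM⇔Gap = mk⇔ (λ (s , bt , g) → inj₁ s , refl , Equivalence.from Between⇔ bt , g)
                   λ { (inj₁ s , _ , bt , g) → s , Equivalence.to Between⇔ bt , g ; (inj₂ _ , () , _) }

    GapL⇔Gap : ∀ {i j} → GapL Q i j ⇔ Gap _≤Q_ (inj₂ i) (inj₂ j)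
    GapL⇔Gap = mk⇔ (λ (s , bt , g) → inj₂ s , refl , Equivalence.from Between⇔ bt , g)
                   λ { (inj₂ s , _ , bt , g) → s , Equivalence.to Between⇔ bt , g ; (inj₁ _ , () , _) }

    conditionM⇔ : ∀ {i j} → (LinkM Q i j ⊎ ¬ GapM Q i j)
                          ⇔ (Link _≤Q_ (inj₁ i) (inj₁ j) ⊎ ¬ Gap _≤Q_ (inj₁ i) (inj₁ j))
    conditionM⇔ = LinkM⇔Link ⊎-cong ¬-cong-⇔ GapM⇔Gap

    conditionL⇔ : ∀ {i j} → (LinkL Q i j ⊎ ¬ GapL Q i j)
                          ⇔ (Link _≤Q_ (inj₂ i) (inj₂ j) ⊎ ¬ Gap _≤Q_ (inj₂ i) (inj₂ j))
    conditionL⇔ = LinkL⇔Link ⊎-cong ¬-cong-⇔ GapL⇔Gap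

    isGood⇒isGoodRectangular : IsGood _≤Q_ → IsGoodRectangular Q
    isGood⇒isGoodRectangular good = record
      { preorder   = (λ _ → G.reflexive) , (λ _ _ _ → G.transitive)
      ; orthogonal = λ _ _ → G.orthogonal λ ()
      ; parallelM₁ = λ _ _ → Equivalence.to (⇔-trans (G.parallel refl) (⇔-sym conditionM⇔))
      ; parallelM₂ = λ _ _ → Equivalence.from (⇔-trans (G.parallel refl) (⇔-sym conditionM⇔))
      ; parallelL₁ = λ _ _ → Equivalence.to (⇔-trans (G.parallel refl) (⇔-sym conditionL⇔))
      ; parallelL₂ = λ _ _ → Equivalence.from (⇔-trans (G.parallel refl) (⇔-sym conditionL⇔))
      }
      where module G = IsGood good

    isGoodRectangular⇒isGood : IsGoodRectangular Q → IsGood _≤Q_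
    isGoodRectangular⇒isGood good = record
      { reflexive  = proj₁ preorder _
      ; transitive = proj₂ preorder _ _ _
      ; orthogonal = orthogonal′
      ; parallel   = parallel′
      }
      where
      open IsGoodRectangular good
      orthogonal′ : ¬ Parallel a b → Comparable _≤Q_ a b
      orthogonal′ {inj₁ i} {inj₂ j} _ = orthogonal i j
      orthogonal′ {inj₂ i} {inj₁ j} _ = swap (orthogonal j i)
      orthogonal′ {inj₁ _} {inj₁ _} a∦b = ⊥-elim (a∦b refl)
      orthogonal′ {inj₂ _} {inj₂ _} a∦b = ⊥-elim (a∦b refl)
      parallel′ : Parallel a b → Comparable _≤Q_ a b ⇔ (Link _≤Q_ a b ⊎ ¬ Gap _≤Q_ a b)
      parallel′ {inj₁ i} {inj₁ j} _ = ⇔-trans (mk⇔ (parallelM₁ i j) (parallelM₂ i j)) conditionM⇔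
      parallel′ {inj₂ i} {inj₂ j} _ = ⇔-trans (mk⇔ (parallelL₁ i j) (parallelL₂ i j)) conditionL⇔
      parallel′ {inj₁ _} {inj₂ _} ()
      parallel′ {inj₂ _} {inj₁ _} ()

  module Splitting (E : Rel m n) (E-good : IsGoodRectangular E) (lo hi : Coll m n) (lo≢hi : lo ≢ hi)
                   (lo≤hi : _≤R_ E lo hi) (hi≤lo : _≤R_ E hi lo)
                   (unique : ∀ {u v} → _≤R_ E u v → _≤R_ E v u →
                             u ≡ v ⊎ (u ≡ lo × v ≡ hi) ⊎ (u ≡ hi × v ≡ lo))
                   where

    _≤E_ : BinRel (Coll m n) 0ℓ
    _≤E_ = _≤R_ E

    private module E = IsGood (isGoodRectangular⇒isGood E E-good)

    E? : Decidable _≤E_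
    E? a b = rel E a b ≟ᵇ true

    class-of-lo : lo ≤E s → s ≤E lo → s ≡ lo ⊎ s ≡ hi
    class-of-lo lo≤s s≤lo with unique s≤lo lo≤s
    ... | inj₁ s≡lo               = inj₁ s≡lo
    ... | inj₂ (inj₁ (_ , lo≡hi)) = ⊥-elim (lo≢hi lo≡hi)
    ... | inj₂ (inj₂ (s≡hi , _))  = inj₂ s≡hi

    class-of-lo-parallel : Parallel lo hi → s ≡ lo ⊎ s ≡ hi → Parallel lo s
    class-of-lo-parallel p (inj₁ refl) = refl
    class-of-lo-parallel p (inj₂ refl) = p

    no-link-lo-hi : Parallel lo hi → ¬ Link _≤E_ lo hi
    no-link-lo-hi p (t , lo∦t , inj₁ (lo≤t , t≤hi)) =
      lo∦t (class-of-lo-parallel p (class-of-lo lo≤t (E.transitive t≤hi hi≤lo)))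
    no-link-lo-hi p (t , lo∦t , inj₂ (hi≤t , t≤lo)) =
      lo∦t (class-of-lo-parallel p (class-of-lo (E.transitive lo≤hi hi≤t) t≤lo))

    no-gap-lo-hi : {Q : BinRel (Coll m n) 0ℓ} → Q ⇒ _≤E_ → Reflexive Q → Parallel lo hi → ¬ Gap Q lo hi
    no-gap-lo-hi Q⇒E Q-refl p (s , ps , bt , (lo≤s , ¬s≤lo) , (hi≤s , ¬s≤hi)) =
      [ no-link-lo-hi p , (λ ¬gap → ¬gap (s , ps , bt , (Q⇒E lo≤s , s≰lo) , (Q⇒E hi≤s , s≰hi))) ]′
        (Equivalence.to (E.parallel p) (inj₁ lo≤hi))
      where
      s≰lo : ¬ s ≤E lo
      s≰lo s≤lo with class-of-lo (Q⇒E lo≤s) s≤lo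
      ... | inj₁ refl = ¬s≤lo Q-refl
      ... | inj₂ refl = ¬s≤hi Q-refl
      s≰hi : ¬ s ≤E hi
      s≰hi s≤hi = s≰lo (E.transitive s≤hi hi≤lo)

    comparable-lo-hi : {Q : BinRel (Coll m n) 0ℓ} → IsGood Q → Q ⇒ _≤E_ → Comparable Q lo hi
    comparable-lo-hi Q-good Q⇒E with parallel? lo hi
    ... | no lo∦hi = IsGood.orthogonal Q-good lo∦hi
    ... | yes p    =
      Equivalence.from (IsGood.parallel Q-good p) (inj₂ (no-gap-lo-hi Q⇒E (IsGood.reflexive Q-good) p))

    Split : BinRel (Coll m n) 0ℓ
    Split a b = a ≤E b × ¬ (a ≡ hi × b ≡ lo)

    Split? : Decidable Split
    Split? a b = E? a b ×-dec ¬? (a ≟ hi ×-dec b ≟ lo)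

    Split-refl : Reflexive Split
    Split-refl = E.reflexive , λ (a≡hi , a≡lo) → lo≢hi (trans (sym a≡lo) a≡hi)

    Split-trans : Transitive Split
    Split-trans (ab , ab≢hl) (bc , bc≢hl) = E.transitive ab bc , λ { (refl , refl) →
      [ (λ b≡lo → ab≢hl (refl , b≡lo)) , (λ b≡hi → bc≢hl (b≡hi , refl)) ]′
        (class-of-lo (E.transitive lo≤hi ab) bc) }

    Split-antisym : Antisymmetric _≡_ Split
    Split-antisym (ab , ab≢hl) (ba , ba≢hl) with unique ab ba
    ... | inj₁ a≡b                  = a≡b
    ... | inj₂ (inj₁ (a≡lo , b≡hi)) = ⊥-elim (ba≢hl (b≡hi , a≡lo))
    ... | inj₂ (inj₂ a≡hi×b≡lo)     = ⊥-elim (ab≢hl a≡hi×b≡lo)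

    Split-isPartialOrder : IsPartialOrder _≡_ Split
    Split-isPartialOrder = record
      { isPreorder = record
        { isEquivalence = isEquivalence
        ; reflexive     = λ { refl → Split-refl }
        ; trans         = Split-trans
        }
      ; antisym    = Split-antisym
      }

    Split-lo-hi : Split lo hi
    Split-lo-hi = lo≤hi , lo≢hi ∘ proj₁

    ≤E⇒Comparable-Split : a ≤E b → Comparable Split a b
    ≤E⇒Comparable-Split {a} {b} ab with a ≟ hi | b ≟ lo
    ... | yes refl | yes refl = inj₂ Split-lo-hi
    ... | no a≢hi  | _        = inj₁ (ab , a≢hi ∘ proj₁)
    ... | _        | no b≢lo  = inj₁ (ab , b≢lo ∘ proj₂)

    Comparable-E⇒Comparable-Split : Comparable _≤E_ a b → Comparable Split a b
    Comparable-E⇒Comparable-Split = [ ≤E⇒Comparable-Split , swap ∘ ≤E⇒Comparable-Split ]′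

    Strict-E⇒Strict-Split : Strict _≤E_ a b → Strict Split a b
    Strict-E⇒Strict-Split (ab , ¬ba) = (ab , λ { (refl , refl) → ¬ba lo≤hi }) , ¬ba ∘ proj₁

    Split-noetherian : WellFounded (flip (Strict Split))
    Split-noetherian = Strict-noetherian Split-isPartialOrder

    Link-Split-oriented : Split a b → Link Split a b → ∃[ t ] (¬ Parallel a t × Split a t × Split t b)
    Link-Split-oriented ab (t , a∦t , inj₁ (at , tb)) = t , a∦t , at , tb
    Link-Split-oriented ab (t , a∦t , inj₂ (bt , ta)) =
      ⊥-elim (a∦t (cong sort (Split-antisym (Split-trans ab bt) ta)))

    Violation : BinRel (Coll m n) 0ℓ
    Violation a b = Parallel a b × ¬ Link Split a b × Gap Split a b

    violation? : Decidable Violation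
    violation? a b = parallel? a b ×-dec ¬? (Link? Split? a b) ×-dec Gap? Split? a b

    ¬Violation⇒ : Parallel a b → ¬ Violation a b → Link Split a b ⊎ ¬ Gap Split a b
    ¬Violation⇒ {a} {b} p ¬v with Link? Split? a b
    ... | yes l = inj₁ l
    ... | no ¬l = inj₂ λ g → ¬v (p , ¬l , g)

    Pruned : BinRel (Coll m n) 0ℓ
    Pruned a b = Split a b × ¬ Violation a b

    pruned? : Decidable Pruned
    pruned? a b = Split? a b ×-dec ¬? (violation? a b)

    Pruned⇒E : Pruned ⇒ _≤E_
    Pruned⇒E = proj₁ ∘ proj₁

    Pruned-refl : Reflexive Pruned
    Pruned-refl {a} = Split-refl , λ (_ , _ , s , as , bt , a<s , _) →
      proj₂ a<s (subst (λ x → Split x a) (sym (Between-self as bt)) Split-refl)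

    Pruned-antisym : Antisymmetric _≡_ Pruned
    Pruned-antisym ab ba = Split-antisym (proj₁ ab) (proj₁ ba)

    Pruned-trans : Transitive Pruned
    Pruned-trans {a} {b} {c} (ab , ¬vab) (bc , ¬vbc) = Split-trans ab bc , ¬vac
      where
      ¬vac : ¬ Violation a c
      ¬vac (pac , ¬lac , s , pas , bt , a<s , c<s) with parallel? a b
      ... | no a∦b = ¬lac (b , a∦b , inj₁ (ab , bc))
      ... | yes pab with ¬Violation⇒ pab ¬vab | ¬Violation⇒ (trans (sym pab) pac) ¬vbc
      ...   | inj₁ lab | _ = let (t , a∦t , at , tb) = Link-Split-oriented ab lab in
                             ¬lac (t , a∦t , inj₁ (at , Split-trans tb bc))
      ...   | _ | inj₁ lbc = let (t , b∦t , bt′ , tc) = Link-Split-oriented bc lbc in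
                             ¬lac (t , b∦t ∘ trans (sym pab) , inj₁ (Split-trans ab bt′ , tc))
      ...   | inj₂ ¬gab | inj₂ ¬gbc = [ (λ bt₁ → ¬gab (s , pas , bt₁ , a<s , b<s)) ,
                                        (λ bt₂ → ¬gbc (s , trans (sym pab) pas , bt₂ , b<s , c<s)) ]′
                                      (Between-split b bt)
        where
        b<s : Strict Split b s
        b<s = ≤-Strict-trans {R = Split} Split-trans bc c<s

    Strict-Split⇒Strict-Pruned : Strict Split a b → ¬ Violation a b → Strict Pruned a b
    Strict-Split⇒Strict-Pruned (ab , ¬ba) ¬v = (ab , ¬v) , ¬ba ∘ proj₁

    -- If the comparability of (a, s) was deleted, the gap s′ of (a, s) above s is again a gap of (a, b).
    gap-lift : Gap Split a b → Gap Pruned a b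
    gap-lift (s , gap) = lift (Split-noetherian s) gap
      where
      lift : ∀ {a b s} → Acc (flip (Strict Split)) s → GapAt Split a b s → Gap Pruned a b
      lift {a} {b} {s} (acc higher) (as , bt , a<s , b<s) with violation? a s | violation? b s
      ... | yes (_ , _ , s′ , as′ , bt′ , a<s′ , s<s′) | _ =
        lift (higher s<s′) (as′ , Between-nested bt bt′ , a<s′ , Strict-trans {R = Split} Split-trans b<s s<s′)
      ... | no _ | yes (bs , _ , s′ , bs′ , bt′ , b<s′ , s<s′) =
        lift (higher s<s′) (trans as (trans (sym bs) bs′) , Between-sym (Between-nested (Between-sym bt) bt′) ,
                            Strict-trans {R = Split} Split-trans a<s s<s′ , b<s′)
      ... | no ¬vas | no ¬vbs =
        s , as , bt , Strict-Split⇒Strict-Pruned a<s ¬vas , Strict-Split⇒Strict-Pruned b<s ¬vbs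

    Strict-Pruned⇒Strict-Split : Strict Pruned a b → Strict Split a b
    Strict-Pruned⇒Strict-Split = Strict-mono {R = Pruned} proj₁ Pruned-refl Split-antisym

    nonparallel-Pruned : ¬ Parallel a b → Split a b → Pruned a b
    nonparallel-Pruned a∦b ab = ab , a∦b ∘ proj₁

    Pruned⇒LinkOrNoGap : Parallel a b → Pruned a b → Link Pruned a b ⊎ ¬ Gap Pruned a b
    Pruned⇒LinkOrNoGap p (_ , ¬v) =
      map (Link-lift {R = Split} nonparallel-Pruned p) (_∘ Gap-map Strict-Pruned⇒Strict-Split) (¬Violation⇒ p ¬v)

    LinkOrNoGap⇒Pruned : Split a b → Link Pruned a b ⊎ ¬ Gap Pruned a b → Pruned a b
    LinkOrNoGap⇒Pruned ab h =
      ab , λ (_ , ¬l , g) → [ ¬l ∘ Link-mono {R = Pruned} proj₁ , (λ ¬g → ¬g (gap-lift g)) ]′ h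

    LinkOrNoGap-Pruned⇒E : Link Pruned a b ⊎ ¬ Gap Pruned a b → Link _≤E_ a b ⊎ ¬ Gap _≤E_ a b
    LinkOrNoGap-Pruned⇒E = map (Link-mono {R = Pruned} Pruned⇒E) (_∘ (gap-lift ∘ Gap-map Strict-E⇒Strict-Split))

    -- For (⇐): a pair incomparable in Split is incomparable in E, which a link or the absence of a gap
    -- in Pruned would contradict, since both transfer to E.
    Pruned-condition : Parallel a b → Comparable Pruned a b ⇔ (Link Pruned a b ⊎ ¬ Gap Pruned a b)
    Pruned-condition p = mk⇔
      [ Pruned⇒LinkOrNoGap p , LinkOrNoGap-sym {R = Pruned} (sym p) ∘ Pruned⇒LinkOrNoGap (sym p) ]′
      (λ h → map (λ ab → LinkOrNoGap⇒Pruned ab h)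
                 (λ ba → LinkOrNoGap⇒Pruned ba (LinkOrNoGap-sym {R = Pruned} p h))
                 (Comparable-E⇒Comparable-Split (Equivalence.from (E.parallel p) (LinkOrNoGap-Pruned⇒E h))))

    Pruned-isGood : IsGood Pruned
    Pruned-isGood = record
      { reflexive  = Pruned-refl
      ; transitive = Pruned-trans
      ; orthogonal = λ a∦b → map (nonparallel-Pruned a∦b) (nonparallel-Pruned (a∦b ∘ sym))
                                 (Comparable-E⇒Comparable-Split (E.orthogonal a∦b))
      ; parallel   = Pruned-condition
      }

    Pruned-lo-hi : Pruned lo hi
    Pruned-lo-hi = Split-lo-hi , λ (p , _ , gap) → no-gap-lo-hi {Q = Split} proj₁ Split-refl p gap

    module _ {Q : BinRel (Coll m n) 0ℓ} (Q-good : IsGood Q) (Q-antisym : Antisymmetric _≡_ Q)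
             (Q⇒E : Q ⇒ _≤E_) (lo≤Qhi : Q lo hi) where

      private module Q = IsGood Q-good

      Q⇒Split : Q ⇒ Split
      Q⇒Split ab = Q⇒E ab , λ { (refl , refl) → lo≢hi (Q-antisym lo≤Qhi ab) }

      Split⇒Q-if-comparable : Split a b → Comparable Q a b → Q a b
      Split⇒Q-if-comparable ab (inj₁ qab) = qab
      Split⇒Q-if-comparable ab (inj₂ qba) = subst (Q _) (Split-antisym ab (Q⇒Split qba)) Q.reflexive

      nonparallel-Split⇒Q : ¬ Parallel a b → Split a b → Q a b
      nonparallel-Split⇒Q a∦b ab = Split⇒Q-if-comparable ab (Q.orthogonal a∦b)

      Pruned⇒Q : Pruned ⇒ Q
      Pruned⇒Q {a} {b} (ab , ¬v) with parallel? a b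
      ... | no a∦b = nonparallel-Split⇒Q a∦b ab
      ... | yes p  = Split⇒Q-if-comparable ab (Equivalence.from (Q.parallel p)
                       (map (Link-lift {R = Split} nonparallel-Split⇒Q p)
                            (_∘ Gap-map (Strict-mono {R = Q} Q⇒Split Q.reflexive Split-antisym)) (¬Violation⇒ p ¬v)))

      Q⇒Pruned : Q ⇒ Pruned
      Q⇒Pruned qab = Q⇒Split qab , λ (p , ¬l , g) →
        [ ¬l ∘ Link-mono {R = Q} Q⇒Split
        , (λ ¬g → ¬g (Gap-map (Strict-mono {R = Pruned} Pruned⇒Q Pruned-refl Q-antisym) (gap-lift g)))
        ]′ (Equivalence.to (Q.parallel p) (inj₁ qab))

    vertex : Rel m n
    vertex = mkRel λ a b → does (pruned? a b)

    vertex⇔Pruned : _≤R_ vertex a b ⇔ Pruned a b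
    vertex⇔Pruned {a} {b} = does-≡-true⇔ (pruned? a b)

    vertex-isVertex : IsVertex vertex
    vertex-isVertex =
      isGood⇒isGoodRectangular vertex
        (IsGood-resp (Equivalence.from vertex⇔Pruned) (Equivalence.to vertex⇔Pruned) Pruned-isGood) ,
      λ _ _ (ab , ba) → Pruned-antisym (Equivalence.to vertex⇔Pruned ab) (Equivalence.to vertex⇔Pruned ba)

    vertex-⊑ : vertex ⊑ E
    vertex-⊑ _ _ = Pruned⇒E ∘ Equivalence.to vertex⇔Pruned

    vertex-lo-hi : _≤R_ vertex lo hi
    vertex-lo-hi = Equivalence.from vertex⇔Pruned Pruned-lo-hi

    vertex-unique : (P : Rel m n) → IsVertex P → P ⊑ E → _≤R_ P lo hi → P ≐ vertex
    vertex-unique P (P-good , P-antisym) P⊑E lo≤Phi a b =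
      ⇔→≡ (mk⇔ (Equivalence.from vertex⇔Pruned ∘ Q⇒Pruned Q-good Q-antisym (P⊑E _ _) lo≤Phi)
               (Pruned⇒Q Q-good Q-antisym (P⊑E _ _) lo≤Phi ∘ Equivalence.to vertex⇔Pruned))
      where
      Q-good : IsGood (_≤R_ P)
      Q-good = isGoodRectangular⇒isGood P P-good
      Q-antisym : Antisymmetric _≡_ (_≤R_ P)
      Q-antisym ab ba = P-antisym _ _ (ab , ba)

mainTheorem10 : (m n : ℕ) → 1 ≤ m → 1 ≤ n → (E : Rel m n) → IsEdge E →
    ∃[ P₁ ] ∃[ P₂ ] ((IsVertex P₁ × P₁ ⊑ E) × (IsVertex P₂ × P₂ ⊑ E) × ¬ (P₁ ≐ P₂) ×
      (∀ (P : Rel m n) → IsVertex P → P ⊑ E → (P ≐ P₁) ⊎ (P ≐ P₂)))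
mainTheorem10 m n _ _ E (E-good , x , y , x≢y , (x≤y , y≤x) , classes) =
  V₁.vertex , V₂.vertex , (V₁.vertex-isVertex , V₁.vertex-⊑) , (V₂.vertex-isVertex , V₂.vertex-⊑) ,
  vertices-differ , only-vertices
  where
  open Collisions m n
  module V₁ = Splitting E E-good x y x≢y x≤y y≤x (λ xy yx → classes _ _ (xy , yx))
  module V₂ = Splitting E E-good y x (x≢y ∘ sym) y≤x x≤y (λ yx xy → map₂ swap (classes _ _ (yx , xy)))

  vertices-differ : ¬ (V₁.vertex ≐ V₂.vertex)
  vertices-differ V₁≐V₂ =
    x≢y (proj₂ V₂.vertex-isVertex x y (trans (sym (V₁≐V₂ x y)) V₁.vertex-lo-hi , V₂.vertex-lo-hi))

  only-vertices : ∀ P → IsVertex P → P ⊑ E → P ≐ V₁.vertex ⊎ P ≐ V₂.vertex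
  only-vertices P P-vertex P⊑E =
    map (V₁.vertex-unique P P-vertex P⊑E) (V₂.vertex-unique P P-vertex P⊑E)
        (V₁.comparable-lo-hi (isGoodRectangular⇒isGood P (proj₁ P-vertex)) (P⊑E _ _))
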